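{- The hypersequent $J=\ \Rightarrow p\,/\!/\,\Rightarrow\Box(\neg\Box\Box p\land\neg\Box\Box q)\,/\!/\,\Rightarrow q$ is valid in the class of $\mathbf{KB}$ (symmetric) Kripke frames.
   Context: A Kripke model $\langle W,R,v\rangle$ has classical truth conditions with $v(\Box\phi,x)=1$ iff $v(\phi,y)=1$ for all $y$ with $xRy$. A hypersequent $\Gamma_1\Rightarrow\Delta_1\,/\!/\,\dots\,/\!/\,\Gamma_n\Rightarrow\Delta_n$ (a list of sequents, each a pair of finite sets of formulas) has a countermodel if there is a branch $w_1,\dots,w_n$ with $w_iRw_{i+1}$ such that at each $w_i$ all formulas of $\Gamma_i$ are true and all formulas of $\Delta_i$ are false; it is valid in a class of frames if it has no countermodel there. -}

module Defs where

open import Data.Nat using (ℕ)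
open import Data.Bool using (Bool; true)
open import Data.List using (List; []; _∷_)
open import Data.List.Relation.Unary.All using (All)
open import Data.Product using (_×_; Σ-syntax)
open import Data.Empty using (⊥)
open import Data.Unit using (⊤)
open import Relation.Binary.PropositionalEquality using (_≡_)
open import Relation.Nullary using (¬_)
open import Level using (Level; suc; _⊔_)

data Formula : Set where
  atom : ℕ → Formula
  ⊥'   : Formula
  ¬'_  : Formula → Formula
  _∧'_ : Formula → Formula → Formula
  _∨'_ : Formula → Formula → Formula
  _⇒'_ : Formula → Formula → Formula
  □_   : Formula → Formula

record Model (a b : Level) : Set (suc (a ⊔ b)) where
  field
    W : Set a
    R : W → W → Set b
    v : ℕ → W → Bool

module _ {a b} (M : Model a b) where
  open Model M

  -- v(φ, x) = 1, with classical truth conditions.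
  Sat : Formula → W → Set (a ⊔ b)
  Sat (atom n) x = Level.Lift (a ⊔ b) (v n x ≡ true)
  Sat ⊥' x = Level.Lift (a ⊔ b) ⊥
  Sat (¬' φ) x = ¬ Sat φ x
  Sat (φ ∧' ψ) x = Sat φ x × Sat ψ x
  Sat (φ ∨' ψ) x = ¬ (¬ Sat φ x × ¬ Sat ψ x)
  Sat (φ ⇒' ψ) x = Sat φ x → Sat ψ x
  Sat (□ φ) x = ∀ y → R x y → Sat φ y

Sequent : Set
Sequent = List Formula × List Formula

Hypersequent : Set
Hypersequent = List Sequent

module _ {a b} (M : Model a b) where
  open Model M

  Refutes : Sequent → W → Set (a ⊔ b)
  Refutes (Γ Data.Product., Δ) w = All (λ φ → Sat M φ w) Γ × All (λ φ → ¬ Sat M φ w) Δ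

  -- A branch w₁ R w₂ R … R wₙ refuting the i-th component at wᵢ, starting from w.
  RefutesFrom : Hypersequent → W → Set (a ⊔ b)
  RefutesFrom [] w = Level.Lift (a ⊔ b) ⊤
  RefutesFrom (S ∷ []) w = Refutes S w
  RefutesFrom (S ∷ S' ∷ H) w = Refutes S w × Σ[ w' ∈ W ] (R w w' × RefutesFrom (S' ∷ H) w')

  Countermodel : Hypersequent → Set (a ⊔ b)
  Countermodel [] = Level.Lift (a ⊔ b) ⊥
  Countermodel (S ∷ H) = Σ[ w ∈ W ] RefutesFrom (S ∷ H) w

Symmetric : ∀ {a b} → Model a b → Set (a ⊔ b)
Symmetric M = ∀ {x y} → R x y → R y x
  where open Model M

ValidKB : ∀ a b → Hypersequent → Set (suc (a ⊔ b))
ValidKB a b H = (M : Model a b) → Symmetric M → ¬ Countermodel M H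

p q : Formula
p = atom 0
q = atom 1

J : Hypersequent
J = ([] Data.Product., p ∷ [])
  ∷ ([] Data.Product., (□ ((¬' (□ (□ p))) ∧' (¬' (□ (□ q))))) ∷ [])
  ∷ ([] Data.Product., q ∷ [])
  ∷ []

{-# OPTIONS --safe #-}
module Submission where

open import Defs
open import Level using (Level)
open import Data.List.Relation.Unary.All using ([]; _∷_)
open import Data.Product using (_,_)

-- Let w₁ R w₂ R w₃ refute J. For any successor y of w₂, symmetry gives the paths
-- y R w₂ R w₁ and y R w₂ R w₃, so □□p fails at y (p is false at w₁) and □□q fails
-- at y (q is false at w₃). Hence □(¬□□p ∧ ¬□□q) holds at w₂, contrary to refutation.

module _ {a b} (M : Model a b) (sym : Symmetric M) where
  open Model M

  □□⇒□-neighbour : ∀ {x y} φ → R x y → Sat M (□ □ φ) y → Sat M (□ φ) x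
  □□⇒□-neighbour φ xRy □□φ = □□φ _ (sym xRy)

mainTheorem11 : ∀ {a b : Level} → ValidKB a b J
mainTheorem11 M sym
  (w₁ , (_ , ¬p ∷ []) , w₂ , w₁Rw₂ , (_ , ¬□[¬□□p∧¬□□q] ∷ []) , w₃ , w₂Rw₃ , (_ , ¬q ∷ [])) =
  ¬□[¬□□p∧¬□□q] λ y w₂Ry →
      (λ □□p → ¬p (□□⇒□-neighbour M sym p w₂Ry □□p w₁ (sym w₁Rw₂)))
    , (λ □□q → ¬q (□□⇒□-neighbour M sym q w₂Ry □□q w₃ w₂Rw₃))
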